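{- Let $G_\tau$ be a bidirected graph without a b-circuit. Then its transitive closure $\mathrm{Ft}(G_\tau)$ has no b-circuit.
   Context: A graph $G=(V,E)$ is finite, with loops and multiple edges allowed. A half-edge is a pair $(e,x)$ with $e$ incident with $x$ (a loop has two half-edges at its vertex). A bidirected graph $G_\tau=(V,E;\tau)$ is a graph with a map $\tau$ assigning $+1$ or $-1$ to every half-edge; an edge with ends $x,y$ and $\tau(e,x)=\alpha,\tau(e,y)=\beta$ is written $\{x^\alpha,y^\beta\}$. A chain is $x_0,e_1,x_1,\ldots,e_k,x_k$ where $e_i$ has ends $x_{i-1},x_i$; when $e_i$ is traversed from $x_{i-1}$ to $x_i$, $\tau(e_i,x_{i-1}),\tau(e_i,x_i)$ denote the values at the corresponding half-edges. For $\alpha,\beta\in\{\pm1\}$ a b-walk from $x^\alpha$ to $y^\beta$ is a chain $x=x_0,e_1,\ldots,e_k,x_k=y$ with $k\ge1$, $\tau(e_1,x_0)=\alpha$, $\tau(e_k,x_k)=\beta$ and $\tau(e_i,x_i)+\tau(e_{i+1},x_i)=0$ for $1\le i\le k-1$. A b-path from $x^\alpha$ to $y^\beta$ is a b-walk from $x^\alpha$ to $y^\beta$ minimal with these properties (no b-walk from $x^\alpha$ to $y^\beta$ has as edge sequence a proper subsequence, in the same order, of its edge sequence); $x=y$ allowed. A b-circuit is a b-path from $x^\alpha$ to $x^{ -\alpha}$ for some vertex $x$ and $\alpha\in\{\pm1\}$. The transitive closure $\mathrm{Ft}(G_\tau)$ is the bidirected graph on $V$ whose edges are those of $G_\tau$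 together with an edge $\{x^\alpha,y^\beta\}$ (a loop if $x=y$) for every $x^\alpha,y^\beta$ such that $G_\tau$ has a b-path from $x^\alpha$ to $y^\beta$. -}

module Defs where

open import Data.Nat using (ℕ; _<_)
open import Data.Fin using (Fin)
open import Data.Bool using (Bool; true; false)
open import Data.Sum using (_⊎_; inj₁; inj₂)
open import Data.Product using (Σ; _×_; _,_; proj₁; ∃-syntax)
open import Data.List using (List; []; _∷_; map; length)
open import Data.List.Relation.Binary.Sublist.Propositional using (_⊆_)
open import Relation.Binary.PropositionalEquality using (_≡_)
open import Relation.Nullary using (¬_)
open import Data.Empty using (⊥)

data Sign : Set where
  plus minus : Sign

neg : Sign → Sign
neg plus  = minus
neg minus = plus

-- A bidirected edge {x^α , y^β} on vertex set Fin n.  The two half-edges are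
-- (e , end 1) = (x , α) and (e , end 2) = (y , β); for a loop x ≡ y and the
-- two half-edges are still distinguished.
record BEdge (n : ℕ) : Set where
  constructor ⟨_^_,_^_⟩
  field
    x₁ : Fin n
    s₁ : Sign
    x₂ : Fin n
    s₂ : Sign
open BEdge public

-- A bidirected graph with vertex set Fin n and edge set E (an arbitrary type;
-- multiple edges are distinct elements of E).
BiGraph : ℕ → Set → Set
BiGraph n E = E → BEdge n

module _ {n : ℕ} {E : Set} (G : BiGraph n E) where

  -- A traversal of an edge: true = from end 1 to end 2, false = reverse.
  Step : Set
  Step = E × Bool

  tailV : Step → Fin n
  tailV (e , true)  = x₁ (G e)
  tailV (e , false) = x₂ (G e)

  headV : Step → Fin n
  headV (e , true)  = x₂ (G e)
  headV (e , false) = x₁ (G e)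

  -- τ(e_i, x_{i-1}) : sign at the half-edge we leave from
  tailS : Step → Sign
  tailS (e , true)  = s₁ (G e)
  tailS (e , false) = s₂ (G e)

  -- τ(e_i, x_i) : sign at the half-edge we arrive at
  headS : Step → Sign
  headS (e , true)  = s₂ (G e)
  headS (e , false) = s₁ (G e)

  WalkFrom : Step → List Step → Fin n → Sign → Set
  WalkFrom s []        y β = headV s ≡ y × headS s ≡ β
  WalkFrom s (t ∷ ts)  y β =
    headV s ≡ tailV t × tailS t ≡ neg (headS s) × WalkFrom t ts y β

  IsBWalk : Fin n → Sign → Fin n → Sign → List Step → Set
  IsBWalk x α y β []       = ⊥
  IsBWalk x α y β (s ∷ ss) = tailV s ≡ x × tailS s ≡ α × WalkFrom s ss y β

  edgeSeq : List Step → List E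
  edgeSeq = map proj₁

  IsBPath : Fin n → Sign → Fin n → Sign → List Step → Set
  IsBPath x α y β w =
    IsBWalk x α y β w ×
    (∀ w′ → IsBWalk x α y β w′ → edgeSeq w′ ⊆ edgeSeq w →
       ¬ (length (edgeSeq w′) < length (edgeSeq w)))

  HasBPath : Fin n → Sign → Fin n → Sign → Set
  HasBPath x α y β = ∃[ w ] IsBPath x α y β w

  HasBCircuit : Set
  HasBCircuit = ∃[ x ] ∃[ α ] HasBPath x α x (neg α)

_⊕_ : {n : ℕ} {E F : Set} → BiGraph n E → BiGraph n F → BiGraph n (E ⊎ F)
(G ⊕ H) (inj₁ e) = G e
(G ⊕ H) (inj₂ f) = H f

-- IsFtExtra G H : the added edges H (indexed by F) are exactly one edge
-- {x^α, y^β} for every (x, α, y, β) such that G has a b-path from x^α to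
-- y^β.  Then G ⊕ H is the transitive closure Ft(G).
record IsFtExtra {n : ℕ} {E F : Set} (G : BiGraph n E) (H : BiGraph n F) : Set where
  field
    sound    : ∀ f → HasBPath G (x₁ (H f)) (s₁ (H f)) (x₂ (H f)) (s₂ (H f))
    complete : ∀ x α y β → HasBPath G x α y β →
               ∃[ f ] (H f ≡ ⟨ x ^ α , y ^ β ⟩)
    unique   : ∀ f g → H f ≡ H g → f ≡ g

module Submission where

-- Every edge {x^α, y^β} that Ft adds to G stands for a b-path of
-- G from x^α to y^β.  Replacing each added edge of a b-walk of Ft(G) by that
-- b-path (reversed when the edge is traversed backwards) gives a b-walk of G
-- with the same ends.  So a b-circuit of Ft(G), i.e. a b-path from x^α to
-- x^{-α}, yields a b-walk of G from x^α to x^{-α}; and a b-walk whose ends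
-- admit no b-path cannot exist, because a shortest sub-walk would be one.

open import Defs
open import Data.Nat using (ℕ; _<_)
open import Data.Nat.Induction using (<-wellFounded)
open import Induction.WellFounded using (Acc; acc)
open import Data.Fin using (Fin)
open import Data.Bool using (true; false; not)
open import Data.Sum using (inj₁; inj₂)
open import Data.Product using (_×_; _,_; proj₁; proj₂; ∃-syntax)
open import Data.List using (List; []; _∷_; _++_; length)
open import Relation.Binary.PropositionalEquality using (_≡_; refl; sym; trans; cong)
open import Relation.Nullary using (¬_)

neg-involutive : ∀ s → neg (neg s) ≡ s
neg-involutive plus  = refl
neg-involutive minus = refl

-- The sign condition at an inner vertex is symmetric, so it survives
-- reading the walk backwards.
neg-swap : ∀ {a b} → a ≡ neg b → b ≡ neg a
neg-swap {b = b} a≡-b = trans (sym (neg-involutive b)) (cong neg (sym a≡-b))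

module Walks {n : ℕ} {E : Set} (K : BiGraph n E) where

  flipStep : Step K → Step K
  flipStep (e , d) = (e , not d)

  tailV-flip : ∀ s → tailV K (flipStep s) ≡ headV K s
  tailV-flip (e , true)  = refl
  tailV-flip (e , false) = refl

  headV-flip : ∀ s → headV K (flipStep s) ≡ tailV K s
  headV-flip (e , true)  = refl
  headV-flip (e , false) = refl

  tailS-flip : ∀ s → tailS K (flipStep s) ≡ headS K s
  tailS-flip (e , true)  = refl
  tailS-flip (e , false) = refl

  headS-flip : ∀ s → headS K (flipStep s) ≡ tailS K s
  headS-flip (e , true)  = refl
  headS-flip (e , false) = refl

  append-walkFrom : ∀ {y β z γ} s ss w → WalkFrom K s ss y β →
                    IsBWalk K y (neg β) z γ w → WalkFrom K s (ss ++ w) z γ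
  append-walkFrom s []       (t ∷ ts) (refl , refl) (t-at-y , t-sign , rest) =
    sym t-at-y , t-sign , rest
  append-walkFrom s (t ∷ ts) w (s→t , t-sign , rest) w-walk =
    s→t , t-sign , append-walkFrom t ts w rest w-walk

  concat-walk : ∀ {x α y β z γ} w₁ w₂ → IsBWalk K x α y β w₁ →
                IsBWalk K y (neg β) z γ w₂ → IsBWalk K x α z γ (w₁ ++ w₂)
  concat-walk (s ∷ ss) w₂ (s-at-x , s-sign , rest) w₂-walk =
    s-at-x , s-sign , append-walkFrom s ss w₂ rest w₂-walk

  revOnto : List (Step K) → List (Step K) → List (Step K)
  revOnto []       suffix = suffix
  revOnto (s ∷ ss) suffix = revOnto ss (flipStep s ∷ suffix)

  reverseWalk : List (Step K) → List (Step K)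
  reverseWalk []       = []
  reverseWalk (s ∷ ss) = revOnto ss (flipStep s ∷ [])

  revOnto-walk : ∀ {x α y β} s ss suffix → WalkFrom K s ss y β →
                 WalkFrom K (flipStep s) suffix x α →
                 IsBWalk K y β x α (revOnto ss (flipStep s ∷ suffix))
  revOnto-walk s []       suffix (refl , refl) back = tailV-flip s , tailS-flip s , back
  revOnto-walk s (t ∷ ts) suffix (s→t , t-sign , rest) back =
    revOnto-walk t ts (flipStep s ∷ suffix) rest (t→s , s-sign , back)
    where
      t→s : headV K (flipStep t) ≡ tailV K (flipStep s)
      t→s = trans (headV-flip t) (trans (sym s→t) (sym (tailV-flip s)))

      s-sign : tailS K (flipStep s) ≡ neg (headS K (flipStep t))
      s-sign = trans (tailS-flip s)
                 (trans (neg-swap t-sign) (cong neg (sym (headS-flip t))))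

  reverse-walk : ∀ {x α y β} w → IsBWalk K x α y β w →
                 IsBWalk K y β x α (reverseWalk w)
  reverse-walk (s ∷ ss) (refl , refl , rest) =
    revOnto-walk s ss [] rest (headV-flip s , headS-flip s)

  split-walk : ∀ {x α y β} s t ts → IsBWalk K x α y β (s ∷ t ∷ ts) →
               IsBWalk K x α (headV K s) (headS K s) (s ∷ []) ×
               IsBWalk K (headV K s) (neg (headS K s)) y β (t ∷ ts)
  split-walk s t ts (s-at-x , s-sign , s→t , t-sign , rest) =
    (s-at-x , s-sign , refl , refl) , sym s→t , t-sign , rest

  -- If there is no b-path from x^α to y^β then there is no b-walk either:
  -- a b-walk that is not a b-path has a strictly shorter b-walk with the same
  -- ends, so by well-founded induction on length we never reach one.
  no-path⇒no-walk : ∀ {x α y β} → ¬ HasBPath K x α y β →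
                    ∀ w → ¬ IsBWalk K x α y β w
  no-path⇒no-walk {x} {α} {y} {β} no-path w = go w (<-wellFounded _)
    where
      go : ∀ w → Acc _<_ (length (edgeSeq K w)) → ¬ IsBWalk K x α y β w
      go w (acc shorter) w-walk =
        no-path (w , w-walk , λ w′ w′-walk _ w′<w → go w′ (shorter w′<w) w′-walk)

open Walks

Realises : {n : ℕ} {E F : Set} → BiGraph n E → BiGraph n F → Set
Realises G H = ∀ f → ∃[ w ] IsBWalk G (x₁ (H f)) (s₁ (H f)) (x₂ (H f)) (s₂ (H f)) w

ft-realises : {n : ℕ} {E F : Set} {G : BiGraph n E} {H : BiGraph n F} →
              IsFtExtra G H → Realises G H
ft-realises {G = G} {H = H} ft f = proj₁ path , proj₁ (proj₂ path)
  where
    path : HasBPath G (x₁ (H f)) (s₁ (H f)) (x₂ (H f)) (s₂ (H f))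
    path = IsFtExtra.sound ft f

module Lift {n : ℕ} {E F : Set} (G : BiGraph n E) (H : BiGraph n F)
            (realise : Realises G H) where

  liftStep : Step (G ⊕ H) → List (Step G)
  liftStep (inj₁ e , d)     = (e , d) ∷ []
  liftStep (inj₂ f , true)  = proj₁ (realise f)
  liftStep (inj₂ f , false) = reverseWalk G (proj₁ (realise f))

  liftStep-walk : ∀ {x α y β} s → IsBWalk (G ⊕ H) x α y β (s ∷ []) →
                  IsBWalk G x α y β (liftStep s)
  liftStep-walk (inj₁ e , true)  s-walk = s-walk
  liftStep-walk (inj₁ e , false) s-walk = s-walk
  liftStep-walk (inj₂ f , true)  (refl , refl , refl , refl) = proj₂ (realise f)
  liftStep-walk (inj₂ f , false) (refl , refl , refl , refl) =
    reverse-walk G (proj₁ (realise f)) (proj₂ (realise f))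

  liftWalk : List (Step (G ⊕ H)) → List (Step G)
  liftWalk []           = []
  liftWalk (s ∷ [])     = liftStep s
  liftWalk (s ∷ t ∷ ts) = liftStep s ++ liftWalk (t ∷ ts)

  lift-walk : ∀ {x α y β} w → IsBWalk (G ⊕ H) x α y β w →
              IsBWalk G x α y β (liftWalk w)
  lift-walk (s ∷ [])     w-walk = liftStep-walk s w-walk
  lift-walk {x} {α} {y} {β} (s ∷ t ∷ ts) w-walk =
    concat-walk G (liftStep s) (liftWalk (t ∷ ts))
      (liftStep-walk s first) (lift-walk (t ∷ ts) rest)
    where
      first : IsBWalk (G ⊕ H) x α (headV (G ⊕ H) s) (headS (G ⊕ H) s) (s ∷ [])
      first = proj₁ (split-walk (G ⊕ H) s t ts w-walk)

      rest : IsBWalk (G ⊕ H) (headV (G ⊕ H) s) (neg (headS (G ⊕ H) s)) y β (t ∷ ts)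
      rest = proj₂ (split-walk (G ⊕ H) s t ts w-walk)

lemma46 : (n m k : ℕ) (G : BiGraph n (Fin m)) (H : BiGraph n (Fin k)) →
          IsFtExtra G H → ¬ HasBCircuit G → ¬ HasBCircuit (G ⊕ H)
lemma46 n m k G H ft no-circuit (x , α , w , w-walk , _) =
  no-path⇒no-walk G (λ path → no-circuit (x , α , path))
    (liftWalk w) (lift-walk w w-walk)
  where open Lift G H (ft-realises ft)
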